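{- For every $\alpha\in\mathcal{L}_{\mathsf{Pr}}$ and every $\beta\in\mathcal{L}_{\mathbf4\mathsf{Pr}}$, $\ell((\alpha^\neg)^{\mathbf4})=\mathcal{O}(\ell(\alpha))$ and $\ell(\beta^\pm)=\mathcal{O}(\ell(\beta))$.
   Context: $\ell(\cdot)$ denotes the length (number of symbols) of a formula. $\mathcal{L}_{\mathsf{BD}}$: $\phi::=p\mid\neg\phi\mid(\phi\wedge\phi)\mid(\phi\vee\phi)$, $p$ from a countable set of variables. $\mathcal{L}_{\mathsf{Pr}}$: $\alpha::=\mathsf{Pr}\phi\mid{\sim}\alpha\mid\neg\alpha\mid\triangle\alpha\mid(\alpha\to\alpha)$ with $\phi\in\mathcal{L}_{\mathsf{BD}}$. $\mathcal{L}_{\mathbf4\mathsf{Pr}}$: $\alpha::=\mathsf{Bl}\phi\mid\mathsf{Db}\phi\mid\mathsf{Cf}\phi\mid\mathsf{Uc}\phi\mid{\sim}\alpha\mid\triangle\alpha\mid(\alpha\to\alpha)$. Abbreviations: $\alpha\oplus\beta={\sim}\alpha\to\beta$, $\alpha\ominus\beta={\sim}(\alpha\to\beta)$. $\alpha^\neg$ is obtained from $\alpha\in\mathcal{L}_{\mathsf{Pr}}$ by successively applying, until no $\neg$ occurs outside the scope of $\mathsf{Pr}$: $\neg\mathsf{Pr}\phi\rightsquigarrow\mathsf{Pr}\neg\phi$, $\neg\neg\alpha\rightsquigarrow\alpha$, $\neg{\sim}\alpha\rightsquigarrow{\sim}\neg\alpha$, $\neg(\alpha\to\alpha')\rightsquigarrow{\sim}(\neg\alpha'\to\neg\alpha)$,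 $\neg\triangle\alpha\rightsquigarrow{\sim}\triangle{\sim}\neg\alpha$. For such formulas, $(\mathsf{Pr}\phi)^{\mathbf4}=\mathsf{Bl}\phi\oplus\mathsf{Cf}\phi$, $({\sim}\alpha)^{\mathbf4}={\sim}\alpha^{\mathbf4}$, $(\triangle\alpha)^{\mathbf4}=\triangle\alpha^{\mathbf4}$, $(\alpha\to\alpha')^{\mathbf4}=\alpha^{\mathbf4}\to\alpha'^{\mathbf4}$. For $\beta\in\mathcal{L}_{\mathbf4\mathsf{Pr}}$: $(\mathsf{Bl}\phi)^\pm=\mathsf{Pr}\phi\ominus\mathsf{Pr}(\phi\wedge\neg\phi)$; $(\mathsf{Cf}\phi)^\pm=\mathsf{Pr}(\phi\wedge\neg\phi)$; $(\mathsf{Uc}\phi)^\pm={\sim}\mathsf{Pr}(\phi\vee\neg\phi)$; $(\mathsf{Db}\phi)^\pm=\mathsf{Pr}\neg\phi\ominus\mathsf{Pr}(\phi\wedge\neg\phi)$; $({\sim}\beta)^\pm={\sim}\beta^\pm$; $(\triangle\beta)^\pm=\triangle\beta^\pm$; $(\beta\to\beta')^\pm=\beta^\pm\to\beta'^\pm$. -}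

module Defs where

open import Data.Nat using (ℕ; _+_)

data BD : Set where
  var  : ℕ → BD
  neg  : BD → BD
  _∧_  : BD → BD → BD
  _∨_  : BD → BD → BD

data LPr : Set where
  Pr   : BD → LPr
  ∼_   : LPr → LPr
  ¬_   : LPr → LPr
  △_   : LPr → LPr
  _⇒_  : LPr → LPr → LPr

data L4Pr : Set where
  Bl Db Cf Uc : BD → L4Pr
  ∼_   : L4Pr → L4Pr
  △_   : L4Pr → L4Pr
  _⇒_  : L4Pr → L4Pr → L4Pr

-- Length = number of symbols (variables, connectives, modalities and the
-- two parentheses around each binary connective each count as one symbol)

ℓBD : BD → ℕ
ℓBD (var _) = 1
ℓBD (neg φ) = 1 + ℓBD φ
ℓBD (φ ∧ ψ) = 3 + ℓBD φ + ℓBD ψ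
ℓBD (φ ∨ ψ) = 3 + ℓBD φ + ℓBD ψ

ℓPr : LPr → ℕ
ℓPr (Pr φ)  = 1 + ℓBD φ
ℓPr (∼ α)   = 1 + ℓPr α
ℓPr (¬ α)   = 1 + ℓPr α
ℓPr (△ α)   = 1 + ℓPr α
ℓPr (α ⇒ β) = 3 + ℓPr α + ℓPr β

ℓ4 : L4Pr → ℕ
ℓ4 (Bl φ)  = 1 + ℓBD φ
ℓ4 (Db φ)  = 1 + ℓBD φ
ℓ4 (Cf φ)  = 1 + ℓBD φ
ℓ4 (Uc φ)  = 1 + ℓBD φ
ℓ4 (∼ α)   = 1 + ℓ4 α
ℓ4 (△ α)   = 1 + ℓ4 α
ℓ4 (α ⇒ β) = 3 + ℓ4 α + ℓ4 β

_⊕4_ : L4Pr → L4Pr → L4Pr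
α ⊕4 β = (∼ α) ⇒ β

_⊖Pr_ : LPr → LPr → LPr
α ⊖Pr β = ∼ (α ⇒ β)

-- α^¬ : formulas of L_Pr with no ¬ outside the scope of Pr

data NF : Set where
  Pr   : BD → NF
  ∼_   : NF → NF
  △_   : NF → NF
  _⇒_  : NF → NF → NF

-- pushNeg α = α^¬ ; pushNegNeg α = (¬α)^¬ ; the clauses are exactly the
-- rewrite rules ¬Prφ ⇝ Pr¬φ, ¬¬α ⇝ α, ¬~α ⇝ ~¬α, ¬(α→α') ⇝ ~(¬α'→¬α),
-- ¬△α ⇝ ~△~¬α applied exhaustively.
pushNeg    : LPr → NF
pushNegNeg : LPr → NF

pushNeg (Pr φ)  = Pr φ
pushNeg (∼ α)   = ∼ pushNeg α
pushNeg (¬ α)   = pushNegNeg α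
pushNeg (△ α)   = △ pushNeg α
pushNeg (α ⇒ β) = pushNeg α ⇒ pushNeg β

pushNegNeg (Pr φ)  = Pr (neg φ)
pushNegNeg (∼ α)   = ∼ pushNegNeg α
pushNegNeg (¬ α)   = pushNeg α
pushNegNeg (△ α)   = ∼ (△ (∼ pushNegNeg α))
pushNegNeg (α ⇒ β) = ∼ (pushNegNeg β ⇒ pushNegNeg α)

to4 : NF → L4Pr
to4 (Pr φ)  = Bl φ ⊕4 Cf φ
to4 (∼ α)   = ∼ to4 α
to4 (△ α)   = △ to4 α
to4 (α ⇒ β) = to4 α ⇒ to4 β

toPm : L4Pr → LPr
toPm (Bl φ)  = Pr φ ⊖Pr Pr (φ ∧ neg φ)
toPm (Cf φ)  = Pr (φ ∧ neg φ)
toPm (Uc φ)  = ∼ Pr (φ ∨ neg φ)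
toPm (Db φ)  = Pr (neg φ) ⊖Pr Pr (φ ∧ neg φ)
toPm (∼ β)   = ∼ toPm β
toPm (△ β)   = △ toPm β
toPm (β ⇒ γ) = toPm β ⇒ toPm γ

-- A ¬ pushed through an implication is duplicated, so (¬α)^¬ is bounded
-- jointly with α^¬ but measured against ℓ(¬α): the symbols of ¬(α → α') pay
-- for the second copy.  Every other clause of the translations replaces a
-- connective by a context of bounded size, and an atom by a formula
-- containing its argument at most three times.
module Submission where

open import Defs
open import Data.Nat using (ℕ; suc; _*_; _≤_; _+_; s≤s; z≤n)
open import Data.Nat.Properties
  using (+-mono-≤; *-monoˡ-≤; *-monoʳ-≤; *-distribˡ-+; *-identityʳ; ≤-refl; ≤-trans; ≤-reflexive; m≤m+n; m≤n+m)
open import Data.Nat.Tactic.RingSolver using (solve-∀)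
open import Data.Product using (Σ; _×_; _,_)
open import Relation.Binary.PropositionalEquality using (_≡_; subst; sym)

+-mono-≤-scaled : ∀ c a b {x y} → x ≤ c * a → y ≤ c * b → x + y ≤ c * (a + b)
+-mono-≤-scaled c a b {x} {y} p q = subst (x + y ≤_) (sym (*-distribˡ-+ c a b)) (+-mono-≤ p q)

affine-≤-scaled : ∀ {c k m y} x → y ≡ k + m * x → k ≤ c → m ≤ c → y ≤ c * suc x
affine-≤-scaled {c} {k} x y≡k+m*x k≤c m≤c =
  subst (_≤ c * suc x) (sym y≡k+m*x)
    (+-mono-≤-scaled c 1 x (subst (k ≤_) (sym (*-identityʳ c)) k≤c) (*-monoˡ-≤ x m≤c))

ℓ4-to4-Pr-≤ : ∀ φ → ℓ4 (to4 (Pr φ)) ≤ 6 * ℓPr (Pr φ)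
ℓ4-to4-Pr-≤ φ = affine-≤-scaled (ℓBD φ) (length (ℓBD φ)) ≤-refl (m≤m+n 2 4)
  where
  length : ∀ x → 3 + (1 + (1 + x)) + (1 + x) ≡ 6 + 2 * x
  length = solve-∀

ℓ4-to4-pushNeg-≤    : ∀ α → ℓ4 (to4 (pushNeg α)) ≤ 6 * ℓPr α
ℓ4-to4-pushNegNeg-≤ : ∀ α → ℓ4 (to4 (pushNegNeg α)) ≤ 6 * ℓPr (¬ α)

ℓ4-to4-pushNeg-≤ (Pr φ)  = ℓ4-to4-Pr-≤ φ
ℓ4-to4-pushNeg-≤ (∼ α)   = +-mono-≤-scaled 6 1 (ℓPr α) (s≤s z≤n) (ℓ4-to4-pushNeg-≤ α)
ℓ4-to4-pushNeg-≤ (¬ α)   = ℓ4-to4-pushNegNeg-≤ α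
ℓ4-to4-pushNeg-≤ (△ α)   = +-mono-≤-scaled 6 1 (ℓPr α) (s≤s z≤n) (ℓ4-to4-pushNeg-≤ α)
ℓ4-to4-pushNeg-≤ (α ⇒ β) =
  +-mono-≤-scaled 6 (3 + ℓPr α) (ℓPr β)
    (+-mono-≤-scaled 6 3 (ℓPr α) (m≤m+n 3 15) (ℓ4-to4-pushNeg-≤ α))
    (ℓ4-to4-pushNeg-≤ β)

ℓ4-to4-pushNegNeg-≤ (Pr φ)  = ℓ4-to4-Pr-≤ (neg φ)
ℓ4-to4-pushNegNeg-≤ (∼ α)   = +-mono-≤-scaled 6 1 (ℓPr (¬ α)) (s≤s z≤n) (ℓ4-to4-pushNegNeg-≤ α)
ℓ4-to4-pushNegNeg-≤ (¬ α)   = ≤-trans (ℓ4-to4-pushNeg-≤ α) (*-monoʳ-≤ 6 (m≤n+m (ℓPr α) 2))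
ℓ4-to4-pushNegNeg-≤ (△ α)   = +-mono-≤-scaled 6 1 (ℓPr (¬ α)) (m≤m+n 3 3) (ℓ4-to4-pushNegNeg-≤ α)
ℓ4-to4-pushNegNeg-≤ (α ⇒ β) =
  ≤-trans
    (+-mono-≤-scaled 6 (2 + ℓPr (¬ β)) (ℓPr (¬ α))
      (+-mono-≤-scaled 6 2 (ℓPr (¬ β)) (m≤m+n 4 8) (ℓ4-to4-pushNegNeg-≤ β))
      (ℓ4-to4-pushNegNeg-≤ α))
    (≤-reflexive (identity (ℓPr α) (ℓPr β)))
  where
  identity : ∀ a b → 6 * (2 + (1 + b) + (1 + a)) ≡ 6 * (1 + (3 + a + b))
  identity = solve-∀

ℓPr-toPm-≤ : ∀ β → ℓPr (toPm β) ≤ 11 * ℓ4 β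
ℓPr-toPm-≤ (Bl φ)  = affine-≤-scaled (ℓBD φ) (Bl-length (ℓBD φ)) (m≤m+n 10 1) (m≤m+n 3 8)
  where
  Bl-length : ∀ x → 1 + (3 + (1 + x) + (1 + (3 + x + (1 + x)))) ≡ 10 + 3 * x
  Bl-length = solve-∀
ℓPr-toPm-≤ (Db φ)  = affine-≤-scaled (ℓBD φ) (Db-length (ℓBD φ)) ≤-refl (m≤m+n 3 8)
  where
  Db-length : ∀ x → 1 + (3 + (1 + (1 + x)) + (1 + (3 + x + (1 + x)))) ≡ 11 + 3 * x
  Db-length = solve-∀
ℓPr-toPm-≤ (Cf φ)  = affine-≤-scaled (ℓBD φ) (Cf-length (ℓBD φ)) (m≤m+n 5 6) (m≤m+n 2 9)
  where
  Cf-length : ∀ x → 1 + (3 + x + (1 + x)) ≡ 5 + 2 * x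
  Cf-length = solve-∀
ℓPr-toPm-≤ (Uc φ)  = affine-≤-scaled (ℓBD φ) (Uc-length (ℓBD φ)) (m≤m+n 6 5) (m≤m+n 2 9)
  where
  Uc-length : ∀ x → 1 + (1 + (3 + x + (1 + x))) ≡ 6 + 2 * x
  Uc-length = solve-∀
ℓPr-toPm-≤ (∼ β)   = +-mono-≤-scaled 11 1 (ℓ4 β) (s≤s z≤n) (ℓPr-toPm-≤ β)
ℓPr-toPm-≤ (△ β)   = +-mono-≤-scaled 11 1 (ℓ4 β) (s≤s z≤n) (ℓPr-toPm-≤ β)
ℓPr-toPm-≤ (β ⇒ γ) =
  +-mono-≤-scaled 11 (3 + ℓ4 β) (ℓ4 γ)
    (+-mono-≤-scaled 11 3 (ℓ4 β) (m≤m+n 3 30) (ℓPr-toPm-≤ β))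
    (ℓPr-toPm-≤ γ)

lemma3p17 : (Σ ℕ λ c → (α : LPr) → ℓ4 (to4 (pushNeg α)) ≤ c * ℓPr α)
    × (Σ ℕ λ d → (β : L4Pr) → ℓPr (toPm β) ≤ d * ℓ4 β)
lemma3p17 = (6 , ℓ4-to4-pushNeg-≤) , (11 , ℓPr-toPm-≤)
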